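{- Let $M$ be a matroid without loops and without coloops on ground set $E$ with $n=|E|$ and $r=r_M(E)$, and let $\mathcal Z(M)$ be its set of cyclic flats. Then $$C_M(\emptyset)=b^x_{n,r}-\delta_x\Big[\sum_{X}C_M(X)F_M(X)\Big]\quad\text{and}\quad F_M(E)=b^y_{n,r}-\delta_y\Big[\sum_{X}C_M(X)F_M(X)\Big],$$ where both sums range over $X\in\mathcal Z(M)\setminus\{\emptyset,E\}$.
   Context: A flat $X$ of $M$ is cyclic if $M|X$ has no coloops. For a flat $Y$ of $M$, let $\operatorname{ess}(Y)$ be the cyclic flat obtained from $Y$ by removing the coloops of $M|Y$; let $\operatorname{cl}_M$ be the closure operator. For a cyclic flat $X$, the cloud polynomial is $C_M(X)=\sum_{Y}x^{r_M(E)-r_M(Y)}$, summed over all flats $Y$ with $\operatorname{ess}(Y)=X$, and the flock polynomial is $F_M(X)=\sum_{Y}y^{|Y|-r_M(Y)}$, summed over all subsets $Y\subseteq E$ with $\operatorname{cl}_M(Y)=X$. The $\mathbb Z$-linear maps $\delta_x:\mathbb Z[x,y]\to\mathbb Z[x]$ and $\delta_y:\mathbb Z[x,y]\to\mathbb Z[y]$ are defined by: if $f(x,x^{ -1})=\sum_i a_ix^i$ (Laurent polynomial) then $\delta_x(f)=\sum_{i\ge1}a_ix^i$; if $f(y^{ -1},y)=\sum_i b_iy^i$ then $\delta_y(f)=\sum_{i\ge0}b_iy^i$. For $r<n$, $b^x_{n,r}=\sum_{0\le i<r}\binom ni x^{r-i}$ and $b^y_{n,r}=\sum_{r\le i\le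 n}\binom ni y^{i-r}$; and $b^x_{0,0}=b^y_{0,0}=1$. -}

module Defs where

open import Data.Bool using (Bool; true; false; _∧_; if_then_else_)
open import Data.Nat using (ℕ; zero; suc; _+_; _∸_; _≤_; _<_; _≡ᵇ_; _<ᵇ_)
import Data.Nat as ℕ
open import Data.Nat.Combinatorics using (_C_)
open import Data.Integer using (ℤ; +_)
import Data.Integer as ℤ
open import Data.Fin using (Fin)
open import Data.Fin.Subset using (Subset; ⊥; ⊤; ⁅_⁆; _∪_; _∩_; _-_; ∣_∣; _⊆_; inside; outside)
open import Data.Vec using (Vec; []; _∷_; tabulate; lookup)
import Data.Vec.Properties as VecP
import Data.Bool.Properties as BoolP
open import Data.List using (List; []; _∷_; _++_; map; concatMap; filter; upTo)
open import Data.Product using (_×_; _,_)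
open import Relation.Binary.PropositionalEquality using (_≡_)
open import Relation.Nullary using (¬_; Dec)
open import Relation.Nullary.Decidable using (_×-dec_; ¬?)

record Matroid (n : ℕ) : Set where
  field
    rank        : Subset n → ℕ
    rank-bound  : ∀ X → rank X ≤ ∣ X ∣
    rank-mono   : ∀ X Y → X ⊆ Y → rank X ≤ rank Y
    rank-submod : ∀ X Y → rank (X ∪ Y) + rank (X ∩ Y) ≤ rank X + rank Y

open Matroid public

_≟ₛ_ : ∀ {n} (X Y : Subset n) → Dec (X ≡ Y)
_≟ₛ_ = VecP.≡-dec BoolP._≟_

allSubsets : ∀ n → List (Subset n)
allSubsets zero    = [] ∷ []
allSubsets (suc n) = map (outside ∷_) (allSubsets n) ++ map (inside ∷_) (allSubsets n)

module _ {n : ℕ} (M : Matroid n) where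

  rk : ℕ
  rk = rank M ⊤

  cl : Subset n → Subset n
  cl X = tabulate λ e → rank M (X ∪ ⁅ e ⁆) ≡ᵇ rank M X

  IsFlat : Subset n → Set
  IsFlat X = cl X ≡ X

  IsLoop : Fin n → Set
  IsLoop e = rank M ⁅ e ⁆ ≡ 0

  IsColoop : Fin n → Set
  IsColoop e = rank M (⊤ - e) < rank M ⊤

  -- ess(Y): remove from Y the coloops of M|Y
  -- (e ∈ Y is a coloop of M|Y iff r(Y - e) < r(Y), i.e. iff r(Y - e) ≠ r(Y))
  ess : Subset n → Subset n
  ess Y = tabulate λ e → lookup Y e ∧ (rank M (Y - e) ≡ᵇ rank M Y)

  IsCyclicFlat : Subset n → Set
  IsCyclicFlat X = (cl X ≡ X) × (ess X ≡ X)

  isCyclicFlat? : ∀ X → Dec (IsCyclicFlat X)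
  isCyclicFlat? X = (cl X ≟ₛ X) ×-dec (ess X ≟ₛ X)

  cloudSets : Subset n → List (Subset n)
  cloudSets X = filter (λ Y → (cl Y ≟ₛ Y) ×-dec (ess Y ≟ₛ X)) (allSubsets n)

  flockSets : Subset n → List (Subset n)
  flockSets X = filter (λ Y → cl Y ≟ₛ X) (allSubsets n)

-- Polynomials with integer coefficients, as finite lists of terms.
-- Poly1: univariate, term (c , i) means c·t^i.
-- Poly2: bivariate in x,y, term (c , i , j) means c·x^i·y^j.

Poly1 : Set
Poly1 = List (ℤ × ℕ)

Poly2 : Set
Poly2 = List (ℤ × ℕ × ℕ)

coeff1 : Poly1 → ℕ → ℤ
coeff1 []            k = + 0
coeff1 ((c , i) ∷ p) k = (if i ≡ᵇ k then c else + 0) ℤ.+ coeff1 p k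

mul2 : Poly2 → Poly2 → Poly2
mul2 p q = concatMap (λ { (a , i , j) → map (λ { (b , k , l) → (a ℤ.* b , i + k , j + l) }) q }) p

inX : Poly1 → Poly2
inX = map λ { (c , i) → (c , i , 0) }

inY : Poly1 → Poly2
inY = map λ { (c , j) → (c , 0 , j) }

-- δ_x f, given by its coefficient of x^k:
-- f(x,x⁻¹) = Σ c x^(i-j); keep exponents ≥ 1.
-- Coefficient of x^k (k ≥ 1) is the sum of c over terms with i - j = k.
δx : Poly2 → ℕ → ℤ
δx p zero    = + 0
δx []                (suc k) = + 0
δx ((c , i , j) ∷ p) (suc k) = (if i ≡ᵇ suc k + j then c else + 0) ℤ.+ δx p (suc k)

-- δ_y f, given by its coefficient of y^k (k ≥ 0):
-- f(y⁻¹,y) = Σ c y^(j-i); coefficient of y^k is the sum of c over terms with j - i = k.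
δy : Poly2 → ℕ → ℤ
δy []                k = + 0
δy ((c , i , j) ∷ p) k = (if j ≡ᵇ k + i then c else + 0) ℤ.+ δy p k

-- b^x_{n,r} and b^y_{n,r}  (b_{0,0} = 1; otherwise the r < n formula)
bx : ℕ → ℕ → Poly1
bx zero zero = (+ 1 , 0) ∷ []
bx n    r    = map (λ i → (+ (n C i) , r ∸ i)) (upTo r)

by : ℕ → ℕ → Poly1
by zero zero = (+ 1 , 0) ∷ []
by n    r    = map (λ k → (+ (n C (r + k)) , k)) (upTo (suc (n ∸ r)))  -- i = r + k, r ≤ i ≤ n

module _ {n : ℕ} (M : Matroid n) where

  cloud : Subset n → Poly1
  cloud X = map (λ Y → (+ 1 , rk M ∸ rank M Y)) (cloudSets M X)

  flock : Subset n → Poly1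
  flock X = map (λ Y → (+ 1 , ∣ Y ∣ ∸ rank M Y)) (flockSets M X)

  innerCyclicFlats : List (Subset n)
  innerCyclicFlats =
    filter (λ X → isCyclicFlat? M X ×-dec (¬? (X ≟ₛ ⊥) ×-dec ¬? (X ≟ₛ ⊤))) (allSubsets n)

  cfSum : Poly2
  cfSum = concatMap (λ X → mul2 (inX (cloud X)) (inY (flock X))) innerCyclicFlats

module Submission where

-- Every A ⊆ E determines the flat Z = cl A, its cyclic core X = ess Z and Y = A ∩ X. The
-- coloops Z ─ X of M|Z all lie in A, so A = Y ∪ (Z ─ X) with cl Y = X; conversely, for a flat
-- Z and cl Y = ess Z the set Y ∪ (Z ─ ess Z) has closure Z. This bijection A ↔ (X, Z, Y)
-- keeps r(E) - r(A) = r(E) - r(Z) and |A| - r(A) = |Y| - r(Y), hence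
--   Σ_{X ∈ Z(M)} C_M(X) F_M(X) = Σ_{A ⊆ E} x^(r - r(A)) y^(|A| - r(A)).
-- Without loops and coloops F_M(∅) = C_M(E) = 1. Applying δ_x turns the right-hand side into
-- b^x_{n,r}, kills F_M(E) and fixes C_M(∅), because r(Z) < r whenever ess Z = ∅; dually, δ_y
-- gives b^y_{n,r}, kills C_M(∅) and fixes F_M(E).

open import Defs
open import Data.Bool using (Bool; true; false; _∧_; _∨_; not; if_then_else_)
open import Data.Bool.Properties using (∧-zeroʳ; ∧-identityʳ; ∨-zeroʳ)
open import Data.Nat using (ℕ; zero; suc; _+_; _∸_; _≤_; _<_; _≡ᵇ_; z≤n; s≤s; s≤s⁻¹; _≤?_; _<?_)
open import Data.Nat.Properties
open import Algebra.Properties.CommutativeSemigroup +-commutativeSemigroup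
  using () renaming (interchange to +-interchange)
open import Data.Nat.Combinatorics using (_C_; nCk≡nC[n∸k]; nCn≡1; nCk+nC[k+1]≡[n+1]C[k+1]; k>n⇒nCk≡0)
open import Data.Integer as ℤ using (ℤ; _-_) renaming (_+_ to _+ℤ_)
import Data.Integer.Properties as ℤ
open import Data.Fin using (Fin; zero; suc) renaming (_≟_ to _≟ᶠ_)
open import Data.Fin.Subset using (Subset; ⊥; ⊤; ⁅_⁆; _∪_; _∩_; _─_; ∣_∣; _⊆_; inside; outside)
  renaming (_-_ to _∖_)
open import Data.Fin.Subset.Properties
  using (nonempty?; Empty-unique; ∣⊥∣≡0; ∣⁅x⁆∣≡1; p─⊥≡p; ∪-comm; ∪-assoc; ∪-identityˡ; ∪-identityʳ)
open import Data.Vec using ([]; _∷_; lookup; tail)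
open import Data.Vec.Properties
  using (lookup-zipWith; lookup∘tabulate; lookup-replicate; tabulate∘lookup; tabulate-cong; []=⇒lookup; lookup⇒[]=)
open import Data.List using (List; []; _∷_; _++_; map; concatMap; filter; applyUpTo; upTo)
open import Data.List.Properties using (++-identityʳ)
open import Data.Product using (_×_; _,_; proj₁; proj₂)
open import Data.Empty using (⊥-elim)
open import Relation.Binary.PropositionalEquality
open import Relation.Nullary using (¬_; Dec; yes; no; does)
open import Relation.Nullary.Decidable using (_×-dec_; ¬?; dec-true; dec-false)
open import Relation.Unary using (Decidable)
open import Function using (_∘_; id)

private variable
  I I′ : Set

≡ᵇ-true : ∀ {m n} → m ≡ n → (m ≡ᵇ n) ≡ true
≡ᵇ-true {zero}  refl = refl
≡ᵇ-true {suc m} refl = ≡ᵇ-true {m} refl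

≡ᵇ-true⁻¹ : ∀ {m n} → (m ≡ᵇ n) ≡ true → m ≡ n
≡ᵇ-true⁻¹ {zero}  {zero}  _  = refl
≡ᵇ-true⁻¹ {suc m} {suc n} eq = cong suc (≡ᵇ-true⁻¹ eq)

≡ᵇ-false : ∀ {m n} → m ≢ n → (m ≡ᵇ n) ≡ false
≡ᵇ-false {m} {n} m≢n with m ≡ᵇ n in eq
... | true  = ⊥-elim (m≢n (≡ᵇ-true⁻¹ eq))
... | false = refl

bool-ext : ∀ {a b} → (a ≡ true → b ≡ true) → (b ≡ true → a ≡ true) → a ≡ b
bool-ext {true}  {true}  _ _ = refl
bool-ext {false} {false} _ _ = refl
bool-ext {true}  {false} f _ = sym (f refl)
bool-ext {false} {true}  _ g = g refl

≡ᵇ-cong : ∀ {a b c d} → (a ≡ b → c ≡ d) → (c ≡ d → a ≡ b) → (a ≡ᵇ b) ≡ (c ≡ᵇ d)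
≡ᵇ-cong f g = bool-ext (≡ᵇ-true ∘ f ∘ ≡ᵇ-true⁻¹) (≡ᵇ-true ∘ g ∘ ≡ᵇ-true⁻¹)

≡ᵇ-∸-cancel : ∀ {R a s k} → s ≤ a → s ≤ R → (R ∸ s ≡ᵇ k + (a ∸ s)) ≡ (R ≡ᵇ k + a)
≡ᵇ-∸-cancel {R} {a} {s} {k} s≤a s≤R = ≡ᵇ-cong
  (λ eq → begin
    R                  ≡⟨ sym (m∸n+n≡m s≤R) ⟩
    R ∸ s + s          ≡⟨ cong (_+ s) eq ⟩
    k + (a ∸ s) + s    ≡⟨ +-assoc k (a ∸ s) s ⟩
    k + (a ∸ s + s)    ≡⟨ cong (k +_) (m∸n+n≡m s≤a) ⟩
    k + a              ∎)
  (λ eq → trans (cong (_∸ s) eq) (+-∸-assoc k s≤a))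
  where open ≡-Reasoning

∧-≡true : ∀ {a b} → a ∧ b ≡ true → a ≡ true × b ≡ true
∧-≡true {true} {true} _ = refl , refl

true≢false : ∀ {P : Set} → true ≡ false → P
true≢false ()

when : Bool → ℕ → ℕ
when b v = if b then v else 0

when-0 : ∀ b → when b 0 ≡ 0
when-0 true  = refl
when-0 false = refl

when-yes : ∀ {P : Set} (P? : Dec P) {v} → P → when (does P?) v ≡ v
when-yes P? p rewrite dec-true P? p = refl

when-no : ∀ {P : Set} (P? : Dec P) {v} → ¬ P → when (does P?) v ≡ 0
when-no P? ¬p rewrite dec-false P? ¬p = refl

when-≡0 : ∀ {P : Set} (P? : Dec P) {v} → (P → v ≡ 0) → when (does P?) v ≡ 0
when-≡0 (yes p) v≡0 = v≡0 p
when-≡0 (no _)  _   = refl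

∑ : List I → (I → ℕ) → ℕ
∑ []       f = 0
∑ (x ∷ xs) f = f x + ∑ xs f

∑-cong : ∀ (xs : List I) {f g : I → ℕ} → (∀ x → f x ≡ g x) → ∑ xs f ≡ ∑ xs g
∑-cong []       _   = refl
∑-cong (x ∷ xs) f≗g = cong₂ _+_ (f≗g x) (∑-cong xs f≗g)

∑-≡0 : ∀ (xs : List I) {f} → (∀ x → f x ≡ 0) → ∑ xs f ≡ 0
∑-≡0 []       _   = refl
∑-≡0 (x ∷ xs) f≡0 = cong₂ _+_ (f≡0 x) (∑-≡0 xs f≡0)

∑-++ : ∀ (xs ys : List I) f → ∑ (xs ++ ys) f ≡ ∑ xs f + ∑ ys f
∑-++ []       ys f = refl
∑-++ (x ∷ xs) ys f = trans (cong (f x +_) (∑-++ xs ys f)) (sym (+-assoc (f x) _ _))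

∑-+ : ∀ (xs : List I) f g → ∑ xs (λ x → f x + g x) ≡ ∑ xs f + ∑ xs g
∑-+ []       f g = refl
∑-+ (x ∷ xs) f g = trans (cong (f x + g x +_) (∑-+ xs f g)) (+-interchange (f x) (g x) _ _)

∑-when : ∀ (xs : List I) b f → when b (∑ xs f) ≡ ∑ xs (λ x → when b (f x))
∑-when xs true  f = refl
∑-when xs false f = sym (∑-≡0 xs (λ _ → refl))

∑-filter : ∀ {P : I → Set} (P? : Decidable P) (xs : List I) f →
           ∑ (filter P? xs) f ≡ ∑ xs (λ x → when (does (P? x)) (f x))
∑-filter P? []       f = refl
∑-filter P? (x ∷ xs) f with does (P? x)
... | true  = cong (f x +_) (∑-filter P? xs f)
... | false = ∑-filter P? xs f

∑-map : ∀ (h : I′ → I) (xs : List I′) f → ∑ (map h xs) f ≡ ∑ xs (f ∘ h)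
∑-map h []       f = refl
∑-map h (x ∷ xs) f = cong (f (h x) +_) (∑-map h xs f)

∑-comm : ∀ (xs : List I) (ys : List I′) (f : I → I′ → ℕ) →
         ∑ xs (λ x → ∑ ys (f x)) ≡ ∑ ys (λ y → ∑ xs (λ x → f x y))
∑-comm []       ys f = sym (∑-≡0 ys (λ _ → refl))
∑-comm (x ∷ xs) ys f =
  trans (cong (∑ ys (f x) +_) (∑-comm xs ys f)) (sym (∑-+ ys (f x) (λ y → ∑ xs (λ x′ → f x′ y))))

∑-applyUpTo-≡0 : ∀ R (g : ℕ → I) f → (∀ i → i < R → f (g i) ≡ 0) → ∑ (applyUpTo g R) f ≡ 0
∑-applyUpTo-≡0 zero    g f _   = refl
∑-applyUpTo-≡0 (suc R) g f f≡0 =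
  cong₂ _+_ (f≡0 0 (s≤s z≤n)) (∑-applyUpTo-≡0 R (g ∘ suc) f (λ i i<R → f≡0 (suc i) (s≤s i<R)))

∑-applyUpTo-point : ∀ R (g : ℕ → I) f {m} → m < R → (∀ i → i < R → i ≢ m → f (g i) ≡ 0) →
                    ∑ (applyUpTo g R) f ≡ f (g m)
∑-applyUpTo-point (suc R) g f {zero} _ f≡0 =
  trans (cong (f (g 0) +_) (∑-applyUpTo-≡0 R (g ∘ suc) f (λ i i<R → f≡0 (suc i) (s≤s i<R) (λ ()))))
        (+-identityʳ _)
∑-applyUpTo-point (suc R) g f {suc m} (s≤s m<R) f≡0 =
  trans (cong (_+ ∑ (applyUpTo (g ∘ suc) R) f) (f≡0 0 (s≤s z≤n) (λ ())))
        (∑-applyUpTo-point R (g ∘ suc) f m<R (λ i i<R i≢m → f≡0 (suc i) (s≤s i<R) (i≢m ∘ suc-injective)))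

∑-allSubsets-suc : ∀ {n} (f : Subset (suc n) → ℕ) →
  ∑ (allSubsets (suc n)) f ≡ ∑ (allSubsets n) (f ∘ (outside ∷_)) + ∑ (allSubsets n) (f ∘ (inside ∷_))
∑-allSubsets-suc {n} f =
  trans (∑-++ (map (outside ∷_) (allSubsets n)) _ f)
        (cong₂ _+_ (∑-map (outside ∷_) (allSubsets n) f) (∑-map (inside ∷_) (allSubsets n) f))

∑-point : ∀ {n} (W : Subset n) f → (∀ X → X ≢ W → f X ≡ 0) → ∑ (allSubsets n) f ≡ f W
∑-point {zero}  []      f _   = +-identityʳ (f [])
∑-point {suc n} (w ∷ W) f f≡0 = trans (∑-allSubsets-suc f) (split w f≡0)
  where
  tail-≢ : ∀ {b X} → X ≢ W → b ∷ X ≢ b ∷ W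
  tail-≢ X≢W = X≢W ∘ cong tail
  split : ∀ w → (∀ X → X ≢ w ∷ W → f X ≡ 0) →
          ∑ (allSubsets n) (f ∘ (outside ∷_)) + ∑ (allSubsets n) (f ∘ (inside ∷_)) ≡ f (w ∷ W)
  split false f≡0 =
    trans (cong₂ _+_ (∑-point W (f ∘ (outside ∷_)) (λ X → f≡0 (outside ∷ X) ∘ tail-≢))
                     (∑-≡0 (allSubsets n) (λ X → f≡0 (inside ∷ X) (λ ()))))
          (+-identityʳ _)
  split true f≡0 =
    cong₂ _+_ (∑-≡0 (allSubsets n) (λ X → f≡0 (outside ∷ X) (λ ())))
              (∑-point W (f ∘ (inside ∷_)) (λ X → f≡0 (inside ∷ X) ∘ tail-≢))

∑-indicator : ∀ {n} (W : Subset n) (g : Subset n → ℕ) →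
              ∑ (allSubsets n) (λ X → when (does (X ≟ₛ W)) (g X)) ≡ g W
∑-indicator W g = trans (∑-point W (λ X → when (does (X ≟ₛ W)) (g X)) (λ X X≢W → when-no (X ≟ₛ W) X≢W))
                        (when-yes (W ≟ₛ W) refl)

∑-size : ∀ n m → ∑ (allSubsets n) (λ A → when (∣ A ∣ ≡ᵇ m) 1) ≡ n C m
∑-size zero    zero    = refl
∑-size zero    (suc m) = sym (k>n⇒nCk≡0 {0} {suc m} (s≤s z≤n))
∑-size (suc n) m       = trans (∑-allSubsets-suc {n} (λ A → when (∣ A ∣ ≡ᵇ m) 1)) (pascal m)
  where
  nC0≡1 : ∀ n → n C 0 ≡ 1
  nC0≡1 n = trans (nCk≡nC[n∸k] {0} {n} z≤n) (nCn≡1 n)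
  pascal : ∀ m → ∑ (allSubsets n) (λ A → when (∣ A ∣ ≡ᵇ m) 1)
                 + ∑ (allSubsets n) (λ A → when (suc ∣ A ∣ ≡ᵇ m) 1) ≡ suc n C m
  pascal zero    = trans (cong₂ _+_ (trans (∑-size n 0) (nC0≡1 n)) (∑-≡0 (allSubsets n) (λ _ → refl)))
                         (sym (nC0≡1 (suc n)))
  pascal (suc m) = trans (cong₂ _+_ (∑-size n (suc m)) (∑-size n m))
                         (trans (+-comm (n C suc m) (n C m)) (nCk+nC[k+1]≡[n+1]C[k+1] n m))

∑-when-ends : ∀ {n} {P : Subset (suc n) → Set} (P? : Decidable P) → P ⊥ → P ⊤ → ∀ h →
  ∑ (allSubsets (suc n)) (λ X → when (does (P? X)) (h X))
  ≡ h ⊥ + h ⊤ + ∑ (filter (λ X → P? X ×-dec (¬? (X ≟ₛ ⊥) ×-dec ¬? (X ≟ₛ ⊤))) (allSubsets (suc n))) h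
∑-when-ends {n} {P} P? P⊥ P⊤ h = begin
  ∑ S (λ X → when (does (P? X)) (h X))
    ≡⟨ ∑-cong S split ⟩
  ∑ S (λ X → at ⊥ X + at ⊤ X + inner X)
    ≡⟨ ∑-+ S _ inner ⟩
  ∑ S (λ X → at ⊥ X + at ⊤ X) + ∑ S inner
    ≡⟨ cong (_+ ∑ S inner) (∑-+ S (at ⊥) (at ⊤)) ⟩
  ∑ S (at ⊥) + ∑ S (at ⊤) + ∑ S inner
    ≡⟨ cong₂ (λ a b → a + b + ∑ S inner) (end ⊥ P⊥) (end ⊤ P⊤) ⟩
  h ⊥ + h ⊤ + ∑ S inner
    ≡⟨ cong (h ⊥ + h ⊤ +_) (sym (∑-filter inner? S h)) ⟩
  h ⊥ + h ⊤ + ∑ (filter inner? S) h ∎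
  where
  open ≡-Reasoning
  S : List (Subset (suc n))
  S = allSubsets (suc n)
  at : Subset (suc n) → Subset (suc n) → ℕ
  at W X = when (does (X ≟ₛ W)) (when (does (P? X)) (h X))
  inner? : ∀ X → Dec (P X × ¬ X ≡ ⊥ × ¬ X ≡ ⊤)
  inner? X = P? X ×-dec (¬? (X ≟ₛ ⊥) ×-dec ¬? (X ≟ₛ ⊤))
  inner : Subset (suc n) → ℕ
  inner X = when (does (inner? X)) (h X)
  end : ∀ W → P W → ∑ S (at W) ≡ h W
  end W PW = trans (∑-indicator W (λ X → when (does (P? X)) (h X))) (when-yes (P? W) PW)
  split : ∀ X → when (does (P? X)) (h X) ≡ at ⊥ X + at ⊤ X + inner X
  split X with X ≟ₛ ⊥ | X ≟ₛ ⊤ | does (P? X)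
  ... | yes refl | yes ()   | _
  ... | yes _    | no _     | true  = sym (trans (+-identityʳ _) (+-identityʳ _))
  ... | yes _    | no _     | false = refl
  ... | no _     | yes _    | true  = sym (+-identityʳ _)
  ... | no _     | yes _    | false = refl
  ... | no _     | no _     | true  = refl
  ... | no _     | no _     | false = refl

∑-reindex : ∀ {n} {P : Subset n → Subset n → Set} (P? : ∀ Z Y → Dec (P Z Y))
  (φ : Subset n → Subset n → Subset n) (π₁ π₂ : Subset n → Subset n) →
  (∀ A → P (π₁ A) (π₂ A)) → (∀ A → φ (π₁ A) (π₂ A) ≡ A) →
  (∀ Z Y → P Z Y → π₁ (φ Z Y) ≡ Z × π₂ (φ Z Y) ≡ Y) →
  ∀ (g : Subset n → Subset n → ℕ) →
  ∑ (allSubsets n) (λ Z → ∑ (allSubsets n) (λ Y → when (does (P? Z Y)) (g Z Y)))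
  ≡ ∑ (allSubsets n) (λ A → g (π₁ A) (π₂ A))
∑-reindex {n} {P} P? φ π₁ π₂ Pπ φπ πφ g = sym (begin
  ∑ S (λ A → g (π₁ A) (π₂ A))
    ≡⟨ ∑-cong S g-as-sum ⟩
  ∑ S (λ A → ∑ S (λ Z → when (does (Z ≟ₛ π₁ A)) (∑ S (λ Y → when (does (Y ≟ₛ π₂ A)) (g Z Y)))))
    ≡⟨ ∑-cong S (λ A → ∑-cong S (λ Z → ∑-when S _ _)) ⟩
  ∑ S (λ A → ∑ S (λ Z → ∑ S (fibre Z A)))
    ≡⟨ ∑-comm S S _ ⟩
  ∑ S (λ Z → ∑ S (λ A → ∑ S (fibre Z A)))
    ≡⟨ ∑-cong S (λ Z → ∑-comm S S _) ⟩
  ∑ S (λ Z → ∑ S (λ Y → ∑ S (λ A → fibre Z A Y)))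
    ≡⟨ ∑-cong S (λ Z → ∑-cong S (fibre-sum Z)) ⟩
  ∑ S (λ Z → ∑ S (λ Y → when (does (P? Z Y)) (g Z Y))) ∎)
  where
  open ≡-Reasoning
  S : List (Subset n)
  S = allSubsets n
  g-as-sum : ∀ A → g (π₁ A) (π₂ A)
               ≡ ∑ S (λ Z → when (does (Z ≟ₛ π₁ A)) (∑ S (λ Y → when (does (Y ≟ₛ π₂ A)) (g Z Y))))
  g-as-sum A = sym (trans (∑-indicator (π₁ A) (λ Z → ∑ S (λ Y → when (does (Y ≟ₛ π₂ A)) (g Z Y))))
                          (∑-indicator (π₂ A) (g (π₁ A))))
  fibre : Subset n → Subset n → Subset n → ℕ
  fibre Z A Y = when (does (Z ≟ₛ π₁ A)) (when (does (Y ≟ₛ π₂ A)) (g Z Y))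
  fibre-sum : ∀ Z Y → ∑ S (λ A → fibre Z A Y) ≡ when (does (P? Z Y)) (g Z Y)
  fibre-sum Z Y with P? Z Y
  ... | yes p = trans (∑-point (φ Z Y) (λ A → fibre Z A Y) off-φ)
                      (trans (when-yes (Z ≟ₛ _) (sym Zπ)) (when-yes (Y ≟ₛ _) (sym Yπ)))
    where
    Zπ : π₁ (φ Z Y) ≡ Z
    Zπ = proj₁ (πφ Z Y p)
    Yπ : π₂ (φ Z Y) ≡ Y
    Yπ = proj₂ (πφ Z Y p)
    off-φ : ∀ A → A ≢ φ Z Y → fibre Z A Y ≡ 0
    off-φ A A≢φ = when-≡0 (Z ≟ₛ π₁ A) λ { refl →
                  when-≡0 (Y ≟ₛ π₂ A) λ { refl → ⊥-elim (A≢φ (sym (φπ A))) } }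
  ... | no ¬p = ∑-≡0 S λ A → when-≡0 (Z ≟ₛ π₁ A) λ { refl →
                             when-≡0 (Y ≟ₛ π₂ A) λ { refl → ⊥-elim (¬p (Pπ A)) } }

monomials : (I → ℕ) → List I → Poly1
monomials e = map (λ x → (ℤ.+ 1 , e x))

if-+ : ∀ b c s → (if b then ℤ.+ c else ℤ.+ 0) +ℤ ℤ.+ s ≡ ℤ.+ (when b c + s)
if-+ true  c s = refl
if-+ false c s = refl

coeff1-map : ∀ (c e : I → ℕ) (xs : List I) k →
  coeff1 (map (λ x → (ℤ.+ c x , e x)) xs) k ≡ ℤ.+ ∑ xs (λ x → when (e x ≡ᵇ k) (c x))
coeff1-map c e []       k = refl
coeff1-map c e (x ∷ xs) k = trans (cong (t +ℤ_) (coeff1-map c e xs k)) (if-+ (e x ≡ᵇ k) (c x) _)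
  where
  t : ℤ
  t = if e x ≡ᵇ k then ℤ.+ c x else ℤ.+ 0

+a≡+b-+c : ∀ {a b c} → a + c ≡ b → ℤ.+ a ≡ ℤ.+ b - ℤ.+ c
+a≡+b-+c {a} {b} {c} a+c≡b = sym (begin
  ℤ.+ b - ℤ.+ c        ≡⟨ cong (λ x → ℤ.+ x - ℤ.+ c) (sym a+c≡b) ⟩
  ℤ.+ (a + c) - ℤ.+ c  ≡⟨ ℤ.m-n≡m⊖n (a + c) c ⟩
  (a + c) ℤ.⊖ c        ≡⟨ ℤ.⊖-≥ (m≤n+m c a) ⟩
  ℤ.+ (a + c ∸ c)      ≡⟨ cong ℤ.+_ (m+n∸n≡m a c) ⟩
  ℤ.+ a                ∎)
  where open ≡-Reasoning

coeff-bx-0 : ∀ n R → coeff1 (bx (suc n) R) 0 ≡ ℤ.+ 0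
coeff-bx-0 n R = trans (coeff1-map (suc n C_) (R ∸_) (upTo R) 0)
  (cong ℤ.+_ (∑-applyUpTo-≡0 R id _ (λ i i<R → cong (λ b → when b (suc n C i)) (≡ᵇ-false (m>n⇒m∸n≢0 i<R)))))

coeff-bx-suc : ∀ n R k →
  coeff1 (bx (suc n) R) (suc k) ≡ ℤ.+ ∑ (allSubsets (suc n)) (λ A → when (R ≡ᵇ suc k + ∣ A ∣) 1)
coeff-bx-suc n R k = trans (coeff1-map (suc n C_) (R ∸_) (upTo R) (suc k)) (cong ℤ.+_ (sym count))
  where
  count : ∑ (allSubsets (suc n)) (λ A → when (R ≡ᵇ suc k + ∣ A ∣) 1)
          ≡ ∑ (upTo R) (λ i → when (R ∸ i ≡ᵇ suc k) (suc n C i))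
  count with suc k ≤? R
  ... | yes k<R = begin
    ∑ (allSubsets (suc n)) (λ A → when (R ≡ᵇ suc k + ∣ A ∣) 1)
      ≡⟨ ∑-cong (allSubsets (suc n)) (λ A → cong (λ b → when b 1) (≡ᵇ-cong
           (λ eq → sym (trans (cong (_∸ suc k) eq) (m+n∸m≡n (suc k) _)))
           (λ eq → sym (trans (cong (suc k +_) eq) (m+[n∸m]≡n k<R))))) ⟩
    ∑ (allSubsets (suc n)) (λ A → when (∣ A ∣ ≡ᵇ R ∸ suc k) 1)
      ≡⟨ ∑-size (suc n) (R ∸ suc k) ⟩
    suc n C (R ∸ suc k)
      ≡⟨ cong (λ b → when b (suc n C (R ∸ suc k))) (sym (≡ᵇ-true (m∸[m∸n]≡n k<R))) ⟩
    when (R ∸ (R ∸ suc k) ≡ᵇ suc k) (suc n C (R ∸ suc k))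
      ≡⟨ sym (∑-applyUpTo-point R id _ (∸-monoʳ-< (s≤s z≤n) k<R) off) ⟩
    ∑ (upTo R) (λ i → when (R ∸ i ≡ᵇ suc k) (suc n C i)) ∎
    where
    open ≡-Reasoning
    off : ∀ i → i < R → i ≢ R ∸ suc k → when (R ∸ i ≡ᵇ suc k) (suc n C i) ≡ 0
    off i i<R i≢ = cong (λ b → when b (suc n C i)) (≡ᵇ-false {R ∸ i} {suc k} λ eq →
      i≢ (trans (sym (m∸[m∸n]≡n (<⇒≤ i<R))) (cong (R ∸_) eq)))
  ... | no k≮R = trans
    (∑-≡0 (allSubsets (suc n)) λ A → cong (λ b → when b 1) (≡ᵇ-false {R} {suc k + ∣ A ∣} λ eq →
      k≮R (≤-trans (m≤m+n (suc k) _) (≤-reflexive (sym eq)))))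
    (sym (∑-applyUpTo-≡0 R id _ λ i _ → cong (λ b → when b (suc n C i)) (≡ᵇ-false {R ∸ i} {suc k} λ eq →
      k≮R (≤-trans (≤-reflexive (sym eq)) (m∸n≤m R i)))))

coeff-by : ∀ n R k → coeff1 (by (suc n) R) k ≡ ℤ.+ ∑ (allSubsets (suc n)) (λ A → when (∣ A ∣ ≡ᵇ k + R) 1)
coeff-by n R k = trans (coeff1-map (λ j → suc n C (R + j)) id (upTo (suc (suc n ∸ R))) k)
                       (cong ℤ.+_ (trans coefficient (sym (trans (∑-size (suc n) (k + R))
                                                                 (cong (suc n C_) (+-comm k R))))))
  where
  coefficient : ∑ (upTo (suc (suc n ∸ R))) (λ j → when (j ≡ᵇ k) (suc n C (R + j))) ≡ suc n C (R + k)
  coefficient with k <? suc (suc n ∸ R)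
  ... | yes k< = trans (∑-applyUpTo-point _ id _ k< λ j _ j≢k →
                           cong (λ b → when b (suc n C (R + j))) (≡ᵇ-false {j} {k} j≢k))
                       (cong (λ b → when b (suc n C (R + k))) (≡ᵇ-true {k} refl))
  ... | no  k≮ = trans (∑-applyUpTo-≡0 _ id _ λ j j< →
                           cong (λ b → when b (suc n C (R + j))) (≡ᵇ-false {j} {k} λ { refl → k≮ j< }))
                          (sym (k>n⇒nCk≡0 (begin-strict
                            suc n                  ≤⟨ m≤n+m∸n (suc n) R ⟩
                            R + (suc n ∸ R)        <⟨ +-monoʳ-< R (≮⇒≥ k≮) ⟩
                            R + k                  ∎)))
    where open ≤-Reasoning

δx-++ : ∀ p q k → δx (p ++ q) (suc k) ≡ δx p (suc k) +ℤ δx q (suc k)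
δx-++ []                q k = sym (ℤ.+-identityˡ _)
δx-++ ((c , i , j) ∷ p) q k =
  trans (cong (t +ℤ_) (δx-++ p q k)) (sym (ℤ.+-assoc t (δx p (suc k)) (δx q (suc k))))
  where
  t : ℤ
  t = if i ≡ᵇ suc k + j then c else ℤ.+ 0

δy-++ : ∀ p q k → δy (p ++ q) k ≡ δy p k +ℤ δy q k
δy-++ []                q k = sym (ℤ.+-identityˡ _)
δy-++ ((c , i , j) ∷ p) q k = trans (cong (t +ℤ_) (δy-++ p q k)) (sym (ℤ.+-assoc t (δy p k) (δy q k)))
  where
  t : ℤ
  t = if j ≡ᵇ k + i then c else ℤ.+ 0

δx-concatMap : ∀ (h : I → Poly2) (v : I → ℕ) xs k → (∀ x → δx (h x) (suc k) ≡ ℤ.+ v x) →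
               δx (concatMap h xs) (suc k) ≡ ℤ.+ ∑ xs v
δx-concatMap h v []       k _  = refl
δx-concatMap h v (x ∷ xs) k eq = trans (δx-++ (h x) _ k) (cong₂ _+ℤ_ (eq x) (δx-concatMap h v xs k eq))

δy-concatMap : ∀ (h : I → Poly2) (v : I → ℕ) xs k → (∀ x → δy (h x) k ≡ ℤ.+ v x) →
               δy (concatMap h xs) k ≡ ℤ.+ ∑ xs v
δy-concatMap h v []       k _  = refl
δy-concatMap h v (x ∷ xs) k eq = trans (δy-++ (h x) _ k) (cong₂ _+ℤ_ (eq x) (δy-concatMap h v xs k eq))

module _ (e : I → ℕ) (f : I′ → ℕ) where

  private
    mul2-∷ : ∀ t p q → mul2 (t ∷ p) q ≡ mul2 (t ∷ []) q ++ mul2 p q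
    mul2-∷ t p q = cong (_++ mul2 p q) (sym (++-identityʳ _))

  δx-monomials : ∀ xs ys k → δx (mul2 (inX (monomials e xs)) (inY (monomials f ys))) (suc k)
                             ≡ ℤ.+ ∑ xs (λ x → ∑ ys (λ y → when (e x ≡ᵇ suc k + f y) 1))
  δx-monomials []       ys k = refl
  δx-monomials (x ∷ xs) ys k =
    trans (cong (λ p → δx p (suc k)) (mul2-∷ (ℤ.+ 1 , e x , 0) (inX (monomials e xs)) (inY (monomials f ys))))
          (trans (δx-++ (mul2 ((ℤ.+ 1 , e x , 0) ∷ []) (inY (monomials f ys))) _ k)
                 (cong₂ _+ℤ_ (times-x ys) (δx-monomials xs ys k)))
    where
    times-x : ∀ ys → δx (mul2 ((ℤ.+ 1 , e x , 0) ∷ []) (inY (monomials f ys))) (suc k)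
                     ≡ ℤ.+ ∑ ys (λ y → when (e x ≡ᵇ suc k + f y) 1)
    times-x []       = refl
    times-x (y ∷ ys) =
      trans (cong₂ _+ℤ_ (cong (λ a → if a ≡ᵇ suc k + f y then ℤ.+ 1 else ℤ.+ 0) (+-identityʳ (e x)))
                        (times-x ys))
            (if-+ (e x ≡ᵇ suc k + f y) 1 _)

  δy-monomials : ∀ xs ys k → δy (mul2 (inX (monomials e xs)) (inY (monomials f ys))) k
                             ≡ ℤ.+ ∑ xs (λ x → ∑ ys (λ y → when (f y ≡ᵇ k + e x) 1))
  δy-monomials []       ys k = refl
  δy-monomials (x ∷ xs) ys k =
    trans (cong (λ p → δy p k) (mul2-∷ (ℤ.+ 1 , e x , 0) (inX (monomials e xs)) (inY (monomials f ys))))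
          (trans (δy-++ (mul2 ((ℤ.+ 1 , e x , 0) ∷ []) (inY (monomials f ys))) _ k)
                 (cong₂ _+ℤ_ (times-x ys) (δy-monomials xs ys k)))
    where
    times-x : ∀ ys → δy (mul2 ((ℤ.+ 1 , e x , 0) ∷ []) (inY (monomials f ys))) k
                     ≡ ℤ.+ ∑ ys (λ y → when (f y ≡ᵇ k + e x) 1)
    times-x []       = refl
    times-x (y ∷ ys) =
      trans (cong₂ _+ℤ_ (cong (λ a → if f y ≡ᵇ k + a then ℤ.+ 1 else ℤ.+ 0) (+-identityʳ (e x)))
                        (times-x ys))
            (if-+ (f y ≡ᵇ k + e x) 1 _)

infix 4 _⊑_
_⊑_ : ∀ {n} → Subset n → Subset n → Set
p ⊑ q = ∀ i → lookup p i ≡ true → lookup q i ≡ true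

⊑⇒⊆ : ∀ {n} {p q : Subset n} → p ⊑ q → p ⊆ q
⊑⇒⊆ {q = q} p⊑q {i} i∈p = lookup⇒[]= i q (p⊑q i ([]=⇒lookup i∈p))

subset-ext : ∀ {n} {p q : Subset n} → (∀ i → lookup p i ≡ lookup q i) → p ≡ q
subset-ext {p = p} {q} eq = trans (sym (tabulate∘lookup p)) (trans (tabulate-cong eq) (tabulate∘lookup q))

lookup-⊥ : ∀ {n} (i : Fin n) → lookup ⊥ i ≡ false
lookup-⊥ i = lookup-replicate i false

lookup-⊤ : ∀ {n} (i : Fin n) → lookup ⊤ i ≡ true
lookup-⊤ i = lookup-replicate i true

lookup-─ : ∀ {n} (p q : Subset n) i → lookup (p ─ q) i ≡ lookup p i ∧ not (lookup q i)
lookup-─ (x ∷ p) (true  ∷ q) zero    = sym (∧-zeroʳ x)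
lookup-─ (x ∷ p) (false ∷ q) zero    = sym (∧-identityʳ x)
lookup-─ (x ∷ p) (y     ∷ q) (suc i) = lookup-─ p q i

lookup-⁅⁆-≢ : ∀ {n} {c i : Fin n} → c ≢ i → lookup ⁅ c ⁆ i ≡ false
lookup-⁅⁆-≢ {c = zero}  {zero}  c≢i = ⊥-elim (c≢i refl)
lookup-⁅⁆-≢ {c = zero}  {suc i} _   = lookup-⊥ i
lookup-⁅⁆-≢ {c = suc c} {zero}  _   = refl
lookup-⁅⁆-≢ {c = suc c} {suc i} c≢i = lookup-⁅⁆-≢ (c≢i ∘ cong suc)

lookup-⁅⁆⁻¹ : ∀ {n} {c i : Fin n} → lookup ⁅ c ⁆ i ≡ true → c ≡ i
lookup-⁅⁆⁻¹ {c = c} {i} i∈⁅c⁆ with c ≟ᶠ i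
... | yes c≡i = c≡i
... | no  c≢i = true≢false (trans (sym i∈⁅c⁆) (lookup-⁅⁆-≢ c≢i))

∣∣-remove : ∀ {n} (p : Subset n) c → lookup p c ≡ true → ∣ p ∣ ≡ suc ∣ p ∖ c ∣
∣∣-remove (true  ∷ p) zero    _    = cong (suc ∘ ∣_∣) (sym (p─⊥≡p p))
∣∣-remove (true  ∷ p) (suc c) c∈p  = cong suc (∣∣-remove p c c∈p)
∣∣-remove (false ∷ p) (suc c) c∈p  = ∣∣-remove p c c∈p

∣∣-∪-disjoint : ∀ {n} (p q : Subset n) → (∀ i → lookup p i ∧ lookup q i ≡ false) →
                ∣ p ∪ q ∣ ≡ ∣ p ∣ + ∣ q ∣
∣∣-∪-disjoint []          []          _    = refl
∣∣-∪-disjoint (true  ∷ p) (true  ∷ q) disj = true≢false (disj zero)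
∣∣-∪-disjoint (true  ∷ p) (false ∷ q) disj = cong suc (∣∣-∪-disjoint p q (disj ∘ suc))
∣∣-∪-disjoint (false ∷ p) (true  ∷ q) disj =
  trans (cong suc (∣∣-∪-disjoint p q (disj ∘ suc))) (sym (+-suc ∣ p ∣ ∣ q ∣))
∣∣-∪-disjoint (false ∷ p) (false ∷ q) disj = ∣∣-∪-disjoint p q (disj ∘ suc)

module _ {n : ℕ} where

  lookup-∪ : ∀ (p q : Subset n) i → lookup (p ∪ q) i ≡ lookup p i ∨ lookup q i
  lookup-∪ p q i = lookup-zipWith _∨_ i p q

  lookup-∩ : ∀ (p q : Subset n) i → lookup (p ∩ q) i ≡ lookup p i ∧ lookup q i
  lookup-∩ p q i = lookup-zipWith _∧_ i p q

  ⊑⊥⇒≡⊥ : ∀ {p : Subset n} → p ⊑ ⊥ → p ≡ ⊥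
  ⊑⊥⇒≡⊥ p⊑⊥ = subset-ext λ i → bool-ext (p⊑⊥ i) (λ i∈⊥ → true≢false (trans (sym i∈⊥) (lookup-⊥ i)))

  ⊤⊑⇒≡⊤ : ∀ {p : Subset n} → ⊤ ⊑ p → p ≡ ⊤
  ⊤⊑⇒≡⊤ ⊤⊑p = subset-ext λ i → bool-ext (λ _ → lookup-⊤ i) (⊤⊑p i)

  ⊑-∪ˡ : ∀ (p q : Subset n) → p ⊑ p ∪ q
  ⊑-∪ˡ p q i i∈p = trans (lookup-∪ p q i) (cong (_∨ lookup q i) i∈p)

  ∪-monoˡ-⊑ : ∀ {p q} (r : Subset n) → p ⊑ q → p ∪ r ⊑ q ∪ r
  ∪-monoˡ-⊑ {p} {q} r p⊑q i i∈ = trans (lookup-∪ q r i)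
    (table (lookup p i) (lookup q i) (lookup r i) (p⊑q i) (trans (sym (lookup-∪ p r i)) i∈))
    where
    table : ∀ a b c → (a ≡ true → b ≡ true) → a ∨ c ≡ true → b ∨ c ≡ true
    table true  _     _    a⇒b _ = cong (_∨ _) (a⇒b refl)
    table false true  _    _   _ = refl
    table false false true _   _ = refl

  ⊑⇒∪≡ : ∀ {p q : Subset n} → p ⊑ q → p ∪ q ≡ q
  ⊑⇒∪≡ {p} {q} p⊑q = subset-ext λ i → trans (lookup-∪ p q i) (absorb (p⊑q i))
    where
    absorb : ∀ {a b} → (a ≡ true → b ≡ true) → a ∨ b ≡ b
    absorb {true}  a⇒b = sym (a⇒b refl)
    absorb {false} _   = refl

  ⁅⁆-⊑ : ∀ {p : Subset n} {c} → lookup p c ≡ true → ⁅ c ⁆ ⊑ p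
  ⁅⁆-⊑ {p = p} c∈p i i∈⁅c⁆ = subst (λ j → lookup p j ≡ true) (lookup-⁅⁆⁻¹ i∈⁅c⁆) c∈p

  ∖-∪-⁅⁆ : ∀ {p : Subset n} {c} → lookup p c ≡ true → (p ∖ c) ∪ ⁅ c ⁆ ≡ p
  ∖-∪-⁅⁆ {p = p} {c} c∈p = subset-ext λ i →
    trans (lookup-∪ (p ∖ c) ⁅ c ⁆ i) (trans (cong (_∨ lookup ⁅ c ⁆ i) (lookup-─ p ⁅ c ⁆ i))
          (table (lookup p i) (lookup ⁅ c ⁆ i) (⁅⁆-⊑ {p = p} c∈p i)))
    where
    table : ∀ a k → (k ≡ true → a ≡ true) → a ∧ not k ∨ k ≡ a
    table true  true  _   = refl
    table true  false _   = refl
    table false false _   = refl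
    table false true  k⇒a = sym (k⇒a refl)

  ─-⊑ : ∀ (p q : Subset n) → p ─ q ⊑ p
  ─-⊑ p q i i∈ = proj₁ (∧-≡true (trans (sym (lookup-─ p q i)) i∈))

  ∖-⊑ : ∀ (p : Subset n) c → p ∖ c ⊑ p
  ∖-⊑ p c = ─-⊑ p ⁅ c ⁆

  ⊑-∩ʳ : ∀ (p q : Subset n) → p ∩ q ⊑ q
  ⊑-∩ʳ p q i i∈ = proj₂ (∧-≡true (trans (sym (lookup-∩ p q i)) i∈))

  ∪-⊑ : ∀ {p q s : Subset n} → p ⊑ s → q ⊑ s → p ∪ q ⊑ s
  ∪-⊑ {p} {q} p⊑s q⊑s i i∈ with lookup p i in i∈p
  ... | true  = p⊑s i i∈p
  ... | false = q⊑s i (trans (sym (cong (_∨ lookup q i) i∈p)) (trans (sym (lookup-∪ p q i)) i∈))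

  ⊑-∖ : ∀ {p q : Subset n} {c} → p ⊑ q → lookup p c ≡ false → p ⊑ q ∖ c
  ⊑-∖ {p} {q} {c} p⊑q c∉p i i∈p =
    trans (lookup-─ q ⁅ c ⁆ i) (cong₂ _∧_ (p⊑q i i∈p) (cong not (lookup-⁅⁆-≢ c≢i)))
    where
    c≢i : c ≢ i
    c≢i refl = true≢false (trans (sym i∈p) c∉p)

  ─-antimonoʳ-⊑ : ∀ (p : Subset n) {q q′} → q′ ⊑ q → p ─ q ⊑ p ─ q′
  ─-antimonoʳ-⊑ p {q} {q′} q′⊑q i i∈ = trans (lookup-─ p q′ i)
    (table (lookup p i) (lookup q i) (lookup q′ i) (q′⊑q i) (trans (sym (lookup-─ p q i)) i∈))
    where
    table : ∀ a b b′ → (b′ ≡ true → b ≡ true) → a ∧ not b ≡ true → a ∧ not b′ ≡ true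
    table true  false false _      _ = refl
    table true  false true  b′⇒b   _ = b′⇒b refl
    table true  true  _     _     ()
    table false _     _     _     ()

  ─-⊑-∪ : ∀ (p q s : Subset n) → p ─ q ⊑ (s ─ q) ∪ (p ─ s)
  ─-⊑-∪ p q s i i∈ = trans (lookup-∪ (s ─ q) (p ─ s) i)
    (trans (cong₂ _∨_ (lookup-─ s q i) (lookup-─ p s i))
           (table (lookup p i) (lookup q i) (lookup s i) (trans (sym (lookup-─ p q i)) i∈)))
    where
    table : ∀ a b c → a ∧ not b ≡ true → c ∧ not b ∨ a ∧ not c ≡ true
    table true  false true  _ = refl
    table true  false false _ = refl
    table true  true  _    ()
    table false _     _    ()

  ─-─ : ∀ {p q : Subset n} → q ⊑ p → p ─ (p ─ q) ≡ q
  ─-─ {p} {q} q⊑p = subset-ext λ i →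
    trans (lookup-─ p (p ─ q) i) (trans (cong (λ b → lookup p i ∧ not b) (lookup-─ p q i))
          (table (lookup p i) (lookup q i) (q⊑p i)))
    where
    table : ∀ a b → (b ≡ true → a ≡ true) → a ∧ not (a ∧ not b) ≡ b
    table true  true  _   = refl
    table true  false _   = refl
    table false false _   = refl
    table false true  b⇒a = b⇒a refl

  ─-∖-∪ : ∀ {p q : Subset n} {c} → lookup p c ≡ true → lookup q c ≡ true →
          (p ─ q) ∪ ⁅ c ⁆ ≡ p ─ (q ∖ c)
  ─-∖-∪ {p} {q} {c} c∈p c∈q = subset-ext λ i →
    trans (lookup-∪ (p ─ q) ⁅ c ⁆ i) (trans (cong (_∨ lookup ⁅ c ⁆ i) (lookup-─ p q i))
    (trans (table (lookup p i) (lookup q i) (lookup ⁅ c ⁆ i) (⁅⁆-⊑ {p = p} c∈p i) (⁅⁆-⊑ {p = q} c∈q i))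
    (sym (trans (lookup-─ p (q ∖ c) i) (cong (λ b → lookup p i ∧ not b) (lookup-─ q ⁅ c ⁆ i))))))
    where
    table : ∀ a b k → (k ≡ true → a ≡ true) → (k ≡ true → b ≡ true) →
            a ∧ not b ∨ k ≡ a ∧ not (b ∧ not k)
    table true  true  true  _   _   = refl
    table true  false true  _   k⇒b = sym (cong (λ b → true ∧ not (b ∧ false)) (k⇒b refl))
    table false _     true  k⇒a _   = sym (k⇒a refl)
    table true  true  false _   _   = refl
    table true  false false _   _   = refl
    table false true  false _   _   = refl
    table false false false _   _   = refl

  ∩-∪-─ : ∀ {a x z : Subset n} → z ─ x ⊑ a → a ⊑ z → (a ∩ x) ∪ (z ─ x) ≡ a
  ∩-∪-─ {a} {x} {z} z─x⊑a a⊑z = subset-ext λ i →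
    trans (lookup-∪ (a ∩ x) (z ─ x) i) (trans (cong₂ _∨_ (lookup-∩ a x i) (lookup-─ z x i))
          (table (lookup a i) (lookup x i) (lookup z i) (λ e → z─x⊑a i (trans (lookup-─ z x i) e)) (a⊑z i)))
    where
    table : ∀ a x z → (z ∧ not x ≡ true → a ≡ true) → (a ≡ true → z ≡ true) → a ∧ x ∨ z ∧ not x ≡ a
    table true  true  _     _  _  = refl
    table true  false true  _  _  = refl
    table true  false false _  a⇒z = a⇒z refl
    table false true  true  _  _  = refl
    table false true  false _  _  = refl
    table false false true  h  _  = sym (h refl)
    table false false false _  _  = refl

  ∩-─-disjoint : ∀ (a x z : Subset n) i → lookup (a ∩ x) i ∧ lookup (z ─ x) i ≡ false
  ∩-─-disjoint a x z i =
    trans (cong₂ _∧_ (lookup-∩ a x i) (lookup-─ z x i)) (table (lookup a i) (lookup x i) (lookup z i))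
    where
    table : ∀ a x z → (a ∧ x) ∧ (z ∧ not x) ≡ false
    table true  true  true  = refl
    table true  true  false = refl
    table true  false _     = refl
    table false _     _     = refl

  ∪-─-∩ : ∀ {y x z : Subset n} → y ⊑ x → (y ∪ (z ─ x)) ∩ x ≡ y
  ∪-─-∩ {y} {x} {z} y⊑x = subset-ext λ i →
    trans (lookup-∩ (y ∪ (z ─ x)) x i) (trans (cong (_∧ lookup x i) (trans (lookup-∪ y (z ─ x) i)
          (cong (lookup y i ∨_) (lookup-─ z x i)))) (table (lookup y i) (lookup x i) (lookup z i) (y⊑x i)))
    where
    table : ∀ y x z → (y ≡ true → x ≡ true) → (y ∨ z ∧ not x) ∧ x ≡ y
    table true  true  _     _   = refl
    table true  false _     y⇒x = y⇒x refl
    table false true  true  _   = refl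
    table false true  false _   = refl
    table false false true  _   = refl
    table false false false _   = refl

  ∪-─-∪ : ∀ {y x z : Subset n} → y ⊑ x → x ⊑ z → (y ∪ (z ─ x)) ∪ x ≡ z
  ∪-─-∪ {y} {x} {z} y⊑x x⊑z = subset-ext λ i →
    trans (lookup-∪ (y ∪ (z ─ x)) x i) (trans (cong (_∨ lookup x i) (trans (lookup-∪ y (z ─ x) i)
          (cong (lookup y i ∨_) (lookup-─ z x i)))) (table (lookup y i) (lookup x i) (lookup z i) (y⊑x i) (x⊑z i)))
    where
    table : ∀ y x z → (y ≡ true → x ≡ true) → (x ≡ true → z ≡ true) → (y ∨ z ∧ not x) ∨ x ≡ z
    table true  true  true  _   _   = refl
    table true  true  false _   x⇒z = sym (x⇒z refl)
    table true  false _     y⇒x _   = true≢false (sym (y⇒x refl))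
    table false true  true  _   _   = refl
    table false true  false _   x⇒z = sym (x⇒z refl)
    table false false true  _   _   = refl
    table false false false _   _   = refl

Subset-induction : ∀ {n} (P : Subset n → Set) → P ⊥ →
  (∀ S c → lookup S c ≡ true → P (S ∖ c) → P S) → ∀ S → P S
Subset-induction {n} P base step S = go ∣ S ∣ S ≤-refl
  where
  go : ∀ m S → ∣ S ∣ ≤ m → P S
  go m S ∣S∣≤m with nonempty? S
  ... | no ¬ne = subst P (sym (Empty-unique ¬ne)) base
  go zero S ∣S∣≤0 | yes (c , c∈S)
    with () ← ≤-trans (≤-reflexive (sym (∣∣-remove S c ([]=⇒lookup c∈S)))) ∣S∣≤0
  go (suc m) S ∣S∣≤1+m | yes (c , c∈S) =
    step S c c∈S′ (go m (S ∖ c) (s≤s⁻¹ (≤-trans (≤-reflexive (sym (∣∣-remove S c c∈S′))) ∣S∣≤1+m)))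
    where
    c∈S′ : lookup S c ≡ true
    c∈S′ = []=⇒lookup c∈S

-- Rank and closure

module _ {n : ℕ} (M : Matroid n) where

  private
    r : Subset n → ℕ
    r = rank M

  rank-⊑ : ∀ {X Y} → X ⊑ Y → r X ≤ r Y
  rank-⊑ {X} {Y} X⊑Y = rank-mono M X Y (⊑⇒⊆ X⊑Y)

  rank-⊥ : r ⊥ ≡ 0
  rank-⊥ = n≤0⇒n≡0 (≤-trans (rank-bound M ⊥) (≤-reflexive (∣⊥∣≡0 n)))

  rank-≤-rk : ∀ X → r X ≤ rk M
  rank-≤-rk X = rank-⊑ (λ i _ → lookup-⊤ i)

  rank-∪ : ∀ X Y → r (X ∪ Y) ≤ r X + r Y
  rank-∪ X Y = ≤-trans (m≤m+n _ _) (rank-submod M X Y)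

  rank-∪-⁅⁆ : ∀ X e → r (X ∪ ⁅ e ⁆) ≤ suc (r X)
  rank-∪-⁅⁆ X e = begin
    r (X ∪ ⁅ e ⁆)  ≤⟨ rank-∪ X ⁅ e ⁆ ⟩
    r X + r ⁅ e ⁆  ≤⟨ +-monoʳ-≤ (r X) (≤-trans (rank-bound M ⁅ e ⁆) (≤-reflexive (∣⁅x⁆∣≡1 e))) ⟩
    r X + 1        ≡⟨ +-comm (r X) 1 ⟩
    suc (r X)      ∎
    where open ≤-Reasoning

  rank-submod-⊑ : ∀ {X Y I} → I ⊑ X → I ⊑ Y → r (X ∪ Y) + r I ≤ r X + r Y
  rank-submod-⊑ {X} {Y} {I} I⊑X I⊑Y = ≤-trans (+-monoʳ-≤ (r (X ∪ Y)) (rank-⊑ I⊑X∩Y)) (rank-submod M X Y)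
    where
    I⊑X∩Y : I ⊑ X ∩ Y
    I⊑X∩Y i i∈I = trans (lookup-∩ X Y i) (cong₂ _∧_ (I⊑X i i∈I) (I⊑Y i i∈I))

  rank-∪-absorb : ∀ {X Y I} → I ⊑ X → r (I ∪ Y) ≡ r I → r (X ∪ Y) ≡ r X
  rank-∪-absorb {X} {Y} {I} I⊑X rI∪Y≡rI = ≤-antisym (+-cancelʳ-≤ (r I) _ _ (begin
    r (X ∪ Y) + r I        ≤⟨ +-monoˡ-≤ (r I) (rank-⊑ X∪Y⊑) ⟩
    r (X ∪ (I ∪ Y)) + r I  ≤⟨ rank-submod-⊑ I⊑X (⊑-∪ˡ I Y) ⟩
    r X + r (I ∪ Y)        ≡⟨ cong (r X +_) rI∪Y≡rI ⟩
    r X + r I              ∎))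
    (rank-⊑ (⊑-∪ˡ X Y))
    where
    open ≤-Reasoning
    X∪Y⊑ : X ∪ Y ⊑ X ∪ (I ∪ Y)
    X∪Y⊑ i i∈ = trans (lookup-∪ X (I ∪ Y) i) (trans (cong (lookup X i ∨_) (lookup-∪ I Y i))
                  (table (lookup X i) (lookup I i) (lookup Y i) (trans (sym (lookup-∪ X Y i)) i∈)))
      where
      table : ∀ x a y → x ∨ y ≡ true → x ∨ (a ∨ y) ≡ true
      table true  _     _    _ = refl
      table false true  _    _ = refl
      table false false true _ = refl

  -- r (Z ∖ c) < r Z says that c is a coloop of M|Z.
  rank-∪-coloop : ∀ {Z W c} → r (Z ∖ c) < r Z → W ⊑ Z ∖ c → r (W ∪ ⁅ c ⁆) ≡ suc (r W)
  rank-∪-coloop {Z} {W} {c} coloop W⊑ = ≤-antisym (rank-∪-⁅⁆ W c) (+-cancelˡ-< (r Z) _ _ (begin-strict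
    r Z + r W                          ≤⟨ +-monoˡ-≤ (r W) (rank-⊑ Z⊑) ⟩
    r ((Z ∖ c) ∪ (W ∪ ⁅ c ⁆)) + r W    ≤⟨ rank-submod-⊑ W⊑ (⊑-∪ˡ W ⁅ c ⁆) ⟩
    r (Z ∖ c) + r (W ∪ ⁅ c ⁆)          <⟨ +-monoˡ-< (r (W ∪ ⁅ c ⁆)) coloop ⟩
    r Z + r (W ∪ ⁅ c ⁆)                ∎))
    where
    open ≤-Reasoning
    Z⊑ : Z ⊑ (Z ∖ c) ∪ (W ∪ ⁅ c ⁆)
    Z⊑ i i∈Z = trans (lookup-∪ (Z ∖ c) (W ∪ ⁅ c ⁆) i)
      (trans (cong₂ _∨_ (lookup-─ Z ⁅ c ⁆ i) (lookup-∪ W ⁅ c ⁆ i)) (table i∈Z))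
      where
      table : ∀ {z k w} → z ≡ true → z ∧ not k ∨ (w ∨ k) ≡ true
      table {true} {false}         _ = refl
      table {true} {true}  {true}  _ = refl
      table {true} {true}  {false} _ = refl

  lookup-cl : ∀ X e → lookup (cl M X) e ≡ (r (X ∪ ⁅ e ⁆) ≡ᵇ r X)
  lookup-cl X e = lookup∘tabulate _ e

  ∈cl⇒rank≡ : ∀ {X e} → lookup (cl M X) e ≡ true → r (X ∪ ⁅ e ⁆) ≡ r X
  ∈cl⇒rank≡ {X} {e} e∈cl = ≡ᵇ-true⁻¹ (trans (sym (lookup-cl X e)) e∈cl)

  rank≡⇒∈cl : ∀ {X e} → r (X ∪ ⁅ e ⁆) ≡ r X → lookup (cl M X) e ≡ true
  rank≡⇒∈cl {X} {e} eq = trans (lookup-cl X e) (≡ᵇ-true eq)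

  ⊑-cl : ∀ X → X ⊑ cl M X
  ⊑-cl X e e∈X = rank≡⇒∈cl (cong r (trans (∪-comm X ⁅ e ⁆) (⊑⇒∪≡ (⁅⁆-⊑ {p = X} e∈X))))

  rank-∪-⊑cl : ∀ A S → S ⊑ cl M A → r (A ∪ S) ≡ r A
  rank-∪-⊑cl A = Subset-induction (λ S → S ⊑ cl M A → r (A ∪ S) ≡ r A) base step
    where
    base : ⊥ ⊑ cl M A → r (A ∪ ⊥) ≡ r A
    base _ = cong r (∪-identityʳ A)
    step : ∀ S c → lookup S c ≡ true →
           (S ∖ c ⊑ cl M A → r (A ∪ (S ∖ c)) ≡ r A) → S ⊑ cl M A → r (A ∪ S) ≡ r A
    step S c c∈S ih S⊑cl = begin
      r (A ∪ S)                   ≡⟨ cong (λ T → r (A ∪ T)) (sym (∖-∪-⁅⁆ c∈S)) ⟩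
      r (A ∪ ((S ∖ c) ∪ ⁅ c ⁆))   ≡⟨ cong r (sym (∪-assoc A (S ∖ c) ⁅ c ⁆)) ⟩
      r ((A ∪ (S ∖ c)) ∪ ⁅ c ⁆)   ≡⟨ rank-∪-absorb (⊑-∪ˡ A (S ∖ c)) (∈cl⇒rank≡ (S⊑cl c c∈S)) ⟩
      r (A ∪ (S ∖ c))             ≡⟨ ih (λ i → S⊑cl i ∘ ∖-⊑ S c i) ⟩
      r A                         ∎
      where open ≡-Reasoning

  rank-cl : ∀ X → r (cl M X) ≡ r X
  rank-cl X = trans (cong r (sym (⊑⇒∪≡ (⊑-cl X)))) (rank-∪-⊑cl X (cl M X) (λ _ → id))

  cl-mono : ∀ {Y X} → Y ⊑ X → cl M Y ⊑ cl M X
  cl-mono Y⊑X e e∈clY = rank≡⇒∈cl (rank-∪-absorb Y⊑X (∈cl⇒rank≡ e∈clY))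

  cl-≡ : ∀ {Y X} → Y ⊑ X → r Y ≡ r X → cl M Y ≡ cl M X
  cl-≡ {Y} {X} Y⊑X rY≡rX = subset-ext λ e → bool-ext (cl-mono Y⊑X e) (X⊑ e)
    where
    X⊑ : cl M X ⊑ cl M Y
    X⊑ e e∈clX = rank≡⇒∈cl (≤-antisym (begin
      r (Y ∪ ⁅ e ⁆)  ≤⟨ rank-⊑ (∪-monoˡ-⊑ {p = Y} {q = X} ⁅ e ⁆ Y⊑X) ⟩
      r (X ∪ ⁅ e ⁆)  ≡⟨ ∈cl⇒rank≡ e∈clX ⟩
      r X            ≡⟨ sym rY≡rX ⟩
      r Y            ∎) (rank-⊑ (⊑-∪ˡ Y ⁅ e ⁆)))
      where open ≤-Reasoning

  cl-idem : ∀ X → cl M (cl M X) ≡ cl M X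
  cl-idem X = sym (cl-≡ (⊑-cl X) (sym (rank-cl X)))

  rank-∪-≤-∣∣ : ∀ W C → r (W ∪ C) ≤ r W + ∣ C ∣
  rank-∪-≤-∣∣ W C = ≤-trans (rank-∪ W C) (+-monoʳ-≤ (r W) (rank-bound M C))

  -- Cyclic cores and coloops

  lookup-ess : ∀ Z e → lookup (ess M Z) e ≡ lookup Z e ∧ (r (Z ∖ e) ≡ᵇ r Z)
  lookup-ess Z e = lookup∘tabulate _ e

  ess-⊑ : ∀ Z → ess M Z ⊑ Z
  ess-⊑ Z e e∈ = proj₁ (∧-≡true (trans (sym (lookup-ess Z e)) e∈))

  ∈ess⇒rank≡ : ∀ {Z e} → lookup (ess M Z) e ≡ true → r (Z ∖ e) ≡ r Z
  ∈ess⇒rank≡ {Z} {e} e∈ = ≡ᵇ-true⁻¹ (proj₂ (∧-≡true (trans (sym (lookup-ess Z e)) e∈)))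

  ∈─ess⇒coloop : ∀ {Z e} → lookup (Z ─ ess M Z) e ≡ true → r (Z ∖ e) < r Z
  ∈─ess⇒coloop {Z} {e} e∈ = ≤∧≢⇒< (rank-⊑ (∖-⊑ Z e)) λ eq →
    true≢false (trans (sym e∈) (trans (lookup-─ Z (ess M Z) e)
      (trans (cong (λ b → lookup Z e ∧ not b) (lookup-ess Z e)) (table (lookup Z e) (≡ᵇ-true eq)))))
    where
    table : ∀ z {b} → b ≡ true → z ∧ not (z ∧ b) ≡ false
    table true  refl = refl
    table false _    = refl

  rank-─-coloops : ∀ Z S → S ⊑ Z → (∀ e → lookup S e ≡ true → r (Z ∖ e) < r Z) →
                   r (Z ─ S) + ∣ S ∣ ≡ r Z
  rank-─-coloops Z = Subset-induction P base step
    where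
    P : Subset n → Set
    P S = S ⊑ Z → (∀ e → lookup S e ≡ true → r (Z ∖ e) < r Z) → r (Z ─ S) + ∣ S ∣ ≡ r Z
    base : P ⊥
    base _ _ = trans (cong₂ _+_ (cong r (p─⊥≡p Z)) (∣⊥∣≡0 n)) (+-identityʳ (r Z))
    step : ∀ S c → lookup S c ≡ true → P (S ∖ c) → P S
    step S c c∈S ih S⊑Z coloops = begin
      r (Z ─ S) + ∣ S ∣                ≡⟨ cong (r (Z ─ S) +_) (∣∣-remove S c c∈S) ⟩
      r (Z ─ S) + suc ∣ S ∖ c ∣        ≡⟨ +-suc (r (Z ─ S)) ∣ S ∖ c ∣ ⟩
      suc (r (Z ─ S)) + ∣ S ∖ c ∣
        ≡⟨ cong (_+ ∣ S ∖ c ∣) (sym (rank-∪-coloop (coloops c c∈S) Z─S⊑)) ⟩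
      r ((Z ─ S) ∪ ⁅ c ⁆) + ∣ S ∖ c ∣
        ≡⟨ cong (λ T → r T + ∣ S ∖ c ∣) (─-∖-∪ (S⊑Z c c∈S) c∈S) ⟩
      r (Z ─ (S ∖ c)) + ∣ S ∖ c ∣
        ≡⟨ ih (λ i → S⊑Z i ∘ ∖-⊑ S c i) (λ e → coloops e ∘ ∖-⊑ S c e) ⟩
      r Z ∎
      where
      open ≡-Reasoning
      Z─S⊑ : Z ─ S ⊑ Z ∖ c
      Z─S⊑ = ─-antimonoʳ-⊑ Z (⁅⁆-⊑ {p = S} c∈S)

  rank-ess : ∀ Z → r (ess M Z) + ∣ Z ─ ess M Z ∣ ≡ r Z
  rank-ess Z = trans (cong (λ T → r T + ∣ Z ─ ess M Z ∣) (sym (─-─ (ess-⊑ Z))))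
                     (rank-─-coloops Z (Z ─ ess M Z) (─-⊑ Z (ess M Z)) (λ _ → ∈─ess⇒coloop))

  ess-idem : ∀ Z → ess M (ess M Z) ≡ ess M Z
  ess-idem Z = subset-ext λ e → trans (lookup-ess X e) (stays e)
    where
    X : Subset n
    X = ess M Z
    K : Subset n
    K = Z ─ X
    stays : ∀ e → lookup X e ∧ (r (X ∖ e) ≡ᵇ r X) ≡ lookup X e
    stays e with lookup X e in e∈X
    ... | false = refl
    ... | true  = ≡ᵇ-true (≤-antisym (rank-⊑ (∖-⊑ X e)) (+-cancelʳ-≤ ∣ K ∣ _ _ (begin
      r X + ∣ K ∣          ≡⟨ rank-ess Z ⟩
      r Z                  ≡⟨ sym (∈ess⇒rank≡ e∈X) ⟩
      r (Z ∖ e)            ≤⟨ rank-⊑ (─-⊑-∪ Z ⁅ e ⁆ X) ⟩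
      r ((X ∖ e) ∪ K)      ≤⟨ rank-∪-≤-∣∣ (X ∖ e) K ⟩
      r (X ∖ e) + ∣ K ∣    ∎)))
      where open ≤-Reasoning

  -- An element of cl (ess Z) outside ess Z would be a coloop of M|Z spanned by ess Z.
  ess-flat : ∀ Z → IsFlat M Z → IsFlat M (ess M Z)
  ess-flat Z Z-flat = subset-ext λ e → bool-ext (closed e) (⊑-cl X e)
    where
    X : Subset n
    X = ess M Z
    closed : ∀ e → lookup (cl M X) e ≡ true → lookup X e ≡ true
    closed e e∈clX with lookup X e in e∉X
    ... | true  = refl
    ... | false = ⊥-elim (1+n≢n (trans (sym (rank-∪-coloop coloop (⊑-∖ {p = X} {q = Z} (ess-⊑ Z) e∉X)))
                                       (∈cl⇒rank≡ e∈clX)))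
      where
      e∈Z : lookup Z e ≡ true
      e∈Z = subst (λ W → lookup W e ≡ true) Z-flat (cl-mono (ess-⊑ Z) e e∈clX)
      coloop : r (Z ∖ e) < r Z
      coloop = ∈─ess⇒coloop (trans (lookup-─ Z X e) (cong₂ (λ a b → a ∧ not b) e∈Z e∉X))

  ess-cyclic : ∀ Z → IsFlat M Z → IsCyclicFlat M (ess M Z)
  ess-cyclic Z Z-flat = ess-flat Z Z-flat , ess-idem Z

  -- Decomposing a set along its closure

  core : Subset n → Subset n
  core A = A ∩ ess M (cl M A)

  coloops-⊑ : ∀ A → cl M A ─ ess M (cl M A) ⊑ A
  coloops-⊑ A i i∈C with lookup A i in i∉A
  ... | true  = refl
  ... | false = ⊥-elim (<⇒≱ (∈─ess⇒coloop i∈C)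
                  (≤-trans (≤-reflexive (rank-cl A)) (rank-⊑ (⊑-∖ {p = A} {q = cl M A} (⊑-cl A) i∉A))))

  core-∪-coloops : ∀ A → core A ∪ (cl M A ─ ess M (cl M A)) ≡ A
  core-∪-coloops A = ∩-∪-─ (coloops-⊑ A) (⊑-cl A)

  rank-core : ∀ A → r (core A) ≡ r (ess M (cl M A))
  rank-core A = ≤-antisym (rank-⊑ (⊑-∩ʳ A X)) (+-cancelʳ-≤ ∣ K ∣ _ _ (begin
    r X + ∣ K ∣           ≡⟨ rank-ess (cl M A) ⟩
    r (cl M A)            ≡⟨ rank-cl A ⟩
    r A                   ≡⟨ cong r (sym (core-∪-coloops A)) ⟩
    r (core A ∪ K)        ≤⟨ rank-∪-≤-∣∣ (core A) K ⟩
    r (core A) + ∣ K ∣    ∎))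
    where
    open ≤-Reasoning
    X : Subset n
    X = ess M (cl M A)
    K : Subset n
    K = cl M A ─ X

  cl-core : ∀ A → cl M (core A) ≡ ess M (cl M A)
  cl-core A = trans (cl-≡ (⊑-∩ʳ A _) (rank-core A)) (ess-flat (cl M A) (cl-idem A))

  nullity-core : ∀ A → ∣ core A ∣ ∸ r (core A) ≡ ∣ A ∣ ∸ r A
  nullity-core A = sym (begin
    ∣ A ∣ ∸ r A                                   ≡⟨ cong₂ _∸_ ∣A∣≡ rA≡ ⟩
    (∣ K ∣ + ∣ core A ∣) ∸ (∣ K ∣ + r (core A))  ≡⟨ [m+n]∸[m+o]≡n∸o ∣ K ∣ _ _ ⟩
    ∣ core A ∣ ∸ r (core A)                       ∎)
    where
    open ≡-Reasoning
    K : Subset n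
    K = cl M A ─ ess M (cl M A)
    ∣A∣≡ : ∣ A ∣ ≡ ∣ K ∣ + ∣ core A ∣
    ∣A∣≡ = trans (cong ∣_∣ (sym (core-∪-coloops A)))
                 (trans (∣∣-∪-disjoint (core A) K (∩-─-disjoint A _ (cl M A))) (+-comm ∣ core A ∣ ∣ K ∣))
    rA≡ : r A ≡ ∣ K ∣ + r (core A)
    rA≡ = begin
      r A                        ≡⟨ sym (rank-cl A) ⟩
      r (cl M A)                 ≡⟨ sym (rank-ess (cl M A)) ⟩
      r (ess M (cl M A)) + ∣ K ∣  ≡⟨ cong (_+ ∣ K ∣) (sym (rank-core A)) ⟩
      r (core A) + ∣ K ∣          ≡⟨ +-comm (r (core A)) ∣ K ∣ ⟩
      ∣ K ∣ + r (core A)          ∎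

  module _ {Z Y : Subset n} (Z-flat : IsFlat M Z) (clY≡ : cl M Y ≡ ess M Z) where

    private
      Y⊑ess : Y ⊑ ess M Z
      Y⊑ess i i∈Y = subst (λ W → lookup W i ≡ true) clY≡ (⊑-cl Y i i∈Y)

    cl-∪-coloops : cl M (Y ∪ (Z ─ ess M Z)) ≡ Z
    cl-∪-coloops = trans (cl-≡ A⊑Z rA≡rZ) Z-flat
      where
      A : Subset n
      A = Y ∪ (Z ─ ess M Z)
      A⊑Z : A ⊑ Z
      A⊑Z = ∪-⊑ {p = Y} {q = Z ─ ess M Z} {s = Z} (λ i → ess-⊑ Z i ∘ Y⊑ess i) (─-⊑ Z (ess M Z))
      ess⊑clA : ess M Z ⊑ cl M A
      ess⊑clA i i∈ = cl-mono (⊑-∪ˡ Y _) i (subst (λ W → lookup W i ≡ true) (sym clY≡) i∈)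
      rA≡rZ : r A ≡ r Z
      rA≡rZ = trans (sym (rank-∪-⊑cl A (ess M Z) ess⊑clA)) (cong r (∪-─-∪ Y⊑ess (ess-⊑ Z)))

    ∪-coloops-∩ : (Y ∪ (Z ─ ess M Z)) ∩ ess M Z ≡ Y
    ∪-coloops-∩ = ∪-─-∩ Y⊑ess

  -- C_M(X) F_M(X) evaluated by the functional sending x^a y^b to w a b.
  cloudFlock : (ℕ → ℕ → ℕ) → Subset n → ℕ
  cloudFlock w X = ∑ (cloudSets M X) (λ Z → ∑ (flockSets M X) (λ Y → w (rk M ∸ r Z) (∣ Y ∣ ∸ r Y)))

  ∑-cloudFlock : ∀ w → ∑ (allSubsets n) (λ X → when (does (isCyclicFlat? M X)) (cloudFlock w X))
                     ≡ ∑ (allSubsets n) (λ A → w (rk M ∸ r A) (∣ A ∣ ∸ r A))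
  ∑-cloudFlock w = begin
    ∑ S (λ X → when (cyclic X) (cloudFlock w X))
      ≡⟨ ∑-cong S (λ X → trans (cong (when (cyclic X)) (cloudFlock-unfold X)) (∑-when S _ _)) ⟩
    ∑ S (λ X → ∑ S (λ Z → when (cyclic X) (when (does (cloud? X Z)) (flockSum X Z))))
      ≡⟨ ∑-comm S S _ ⟩
    ∑ S (λ Z → ∑ S (λ X → when (cyclic X) (when (does (cloud? X Z)) (flockSum X Z))))
      ≡⟨ ∑-cong S (λ Z → trans (∑-point (ess M Z) _ (off-core Z)) (at-core Z (cl M Z ≟ₛ Z))) ⟩
    ∑ S (λ Z → ∑ S (λ Y → when (does ((cl M Z ≟ₛ Z) ×-dec (cl M Y ≟ₛ ess M Z))) (g Z Y)))
      ≡⟨ ∑-reindex (λ Z Y → (cl M Z ≟ₛ Z) ×-dec (cl M Y ≟ₛ ess M Z))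
                   (λ Z Y → Y ∪ (Z ─ ess M Z)) (cl M) core
                   (λ A → cl-idem A , cl-core A) core-∪-coloops
                   (λ Z Y (Z-flat , clY≡) → split-inverse Z-flat clY≡) g ⟩
    ∑ S (λ A → g (cl M A) (core A))
      ≡⟨ ∑-cong S (λ A → cong₂ w (cong (rk M ∸_) (rank-cl A)) (nullity-core A)) ⟩
    ∑ S (λ A → w (rk M ∸ r A) (∣ A ∣ ∸ r A)) ∎
    where
    open ≡-Reasoning
    S : List (Subset n)
    S = allSubsets n
    cyclic : Subset n → Bool
    cyclic X = does (isCyclicFlat? M X)
    cloud? : ∀ X Z → Dec (IsFlat M Z × ess M Z ≡ X)
    cloud? X Z = (cl M Z ≟ₛ Z) ×-dec (ess M Z ≟ₛ X)
    g : Subset n → Subset n → ℕ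
    g Z Y = w (rk M ∸ r Z) (∣ Y ∣ ∸ r Y)
    flockSum : Subset n → Subset n → ℕ
    flockSum X Z = ∑ S (λ Y → when (does (cl M Y ≟ₛ X)) (g Z Y))
    cloudFlock-unfold : ∀ X → cloudFlock w X ≡ ∑ S (λ Z → when (does (cloud? X Z)) (flockSum X Z))
    cloudFlock-unfold X = trans (∑-filter (cloud? X) S _) (∑-cong S λ Z →
      cong (when (does (cloud? X Z))) (∑-filter (λ Y → cl M Y ≟ₛ X) S _))
    off-core : ∀ Z X → X ≢ ess M Z → when (cyclic X) (when (does (cloud? X Z)) (flockSum X Z)) ≡ 0
    off-core Z X X≢ =
      trans (cong (when (cyclic X)) (when-≡0 (cloud? X Z) λ (_ , ess≡X) → ⊥-elim (X≢ (sym ess≡X))))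
            (when-0 (cyclic X))
    at-core : ∀ Z (flat? : Dec (IsFlat M Z)) →
              when (cyclic (ess M Z)) (when (does (flat? ×-dec (ess M Z ≟ₛ ess M Z))) (flockSum (ess M Z) Z))
              ≡ ∑ S (λ Y → when (does (flat? ×-dec (cl M Y ≟ₛ ess M Z))) (g Z Y))
    at-core Z (yes Z-flat) = trans (when-yes (isCyclicFlat? M (ess M Z)) (ess-cyclic Z Z-flat))
                                   (when-yes (ess M Z ≟ₛ ess M Z) refl)
    at-core Z (no _)       = trans (when-0 (cyclic (ess M Z))) (sym (∑-≡0 S (λ _ → refl)))
    split-inverse : ∀ {Z Y} → IsFlat M Z → cl M Y ≡ ess M Z →
                    cl M (Y ∪ (Z ─ ess M Z)) ≡ Z × core (Y ∪ (Z ─ ess M Z)) ≡ Y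
    split-inverse Z-flat clY≡ = cl-∪-coloops Z-flat clY≡
      , trans (cong (λ W → (_ ∪ _) ∩ ess M W) (cl-∪-coloops Z-flat clY≡)) (∪-coloops-∩ Z-flat clY≡)

  cl-⊥ : (∀ e → ¬ IsLoop M e) → IsFlat M ⊥
  cl-⊥ loopless = subset-ext λ e → trans (lookup-cl ⊥ e) (trans (≡ᵇ-false (not-loop e)) (sym (lookup-⊥ e)))
    where
    not-loop : ∀ e → r (⊥ ∪ ⁅ e ⁆) ≢ r ⊥
    not-loop e eq = loopless e (trans (cong r (sym (∪-identityˡ ⁅ e ⁆))) (trans eq rank-⊥))

  cl-⊤ : IsFlat M ⊤
  cl-⊤ = ⊤⊑⇒≡⊤ (⊑-cl ⊤)

  ess-⊤ : (∀ e → ¬ IsColoop M e) → ess M ⊤ ≡ ⊤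
  ess-⊤ coloopless = ⊤⊑⇒≡⊤ λ e _ → trans (lookup-ess ⊤ e)
    (cong₂ _∧_ (lookup-⊤ e) (≡ᵇ-true (≤-antisym (rank-⊑ (∖-⊑ ⊤ e)) (≮⇒≥ (coloopless e)))))

  ⊥-cyclic : (∀ e → ¬ IsLoop M e) → IsCyclicFlat M ⊥
  ⊥-cyclic loopless = cl-⊥ loopless , ⊑⊥⇒≡⊥ (ess-⊑ ⊥)

  ⊤-cyclic : (∀ e → ¬ IsColoop M e) → IsCyclicFlat M ⊤
  ⊤-cyclic coloopless = cl-⊤ , ess-⊤ coloopless

  ∑-flockSets-⊥ : (∀ e → ¬ IsLoop M e) → ∀ f → ∑ (flockSets M ⊥) f ≡ f ⊥
  ∑-flockSets-⊥ loopless f = trans (∑-filter (λ Y → cl M Y ≟ₛ ⊥) (allSubsets n) f)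
    (trans (∑-point ⊥ _ λ Y Y≢⊥ → when-no (cl M Y ≟ₛ ⊥) λ clY≡⊥ → Y≢⊥ (⊑⊥⇒≡⊥ (⊑-⊥ clY≡⊥)))
           (when-yes (cl M ⊥ ≟ₛ ⊥) (cl-⊥ loopless)))
    where
    ⊑-⊥ : ∀ {Y} → cl M Y ≡ ⊥ → Y ⊑ ⊥
    ⊑-⊥ {Y} clY≡⊥ i i∈Y = subst (λ W → lookup W i ≡ true) clY≡⊥ (⊑-cl Y i i∈Y)

  ∑-cloudSets-⊤ : (∀ e → ¬ IsColoop M e) → ∀ f → ∑ (cloudSets M ⊤) f ≡ f ⊤
  ∑-cloudSets-⊤ coloopless f = trans (∑-filter (λ Z → (cl M Z ≟ₛ Z) ×-dec (ess M Z ≟ₛ ⊤)) (allSubsets n) f)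
    (trans (∑-point ⊤ _ λ Z Z≢⊤ → when-no ((cl M Z ≟ₛ Z) ×-dec (ess M Z ≟ₛ ⊤)) λ (_ , ess≡⊤) →
                                     Z≢⊤ (⊤⊑⇒≡⊤ (⊤-⊑ ess≡⊤)))
           (when-yes ((cl M ⊤ ≟ₛ ⊤) ×-dec (ess M ⊤ ≟ₛ ⊤)) (⊤-cyclic coloopless)))
    where
    ⊤-⊑ : ∀ {Z} → ess M Z ≡ ⊤ → ⊤ ⊑ Z
    ⊤-⊑ {Z} ess≡⊤ i i∈⊤ = ess-⊑ Z i (subst (λ W → lookup W i ≡ true) (sym ess≡⊤) i∈⊤)

  flat-of-full-rank : ∀ {Z} → IsFlat M Z → rk M ∸ r Z ≡ 0 → Z ≡ ⊤
  flat-of-full-rank {Z} Z-flat corank≡0 = ⊤⊑⇒≡⊤ λ e _ → subst (λ W → lookup W e ≡ true) Z-flat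
    (rank≡⇒∈cl (≤-antisym (≤-trans (rank-≤-rk _) (m∸n≡0⇒m≤n corank≡0)) (rank-⊑ (⊑-∪ˡ Z ⁅ e ⁆))))

module _ {n : ℕ} (M : Matroid (suc n))
         (loopless : ∀ e → ¬ IsLoop M e) (coloopless : ∀ e → ¬ IsColoop M e) where

  private
    r : Subset (suc n) → ℕ
    r = rank M

    S : List (Subset (suc n))
    S = allSubsets (suc n)

  cloudFlock-ends : ∀ w → cloudFlock M w ⊥ + cloudFlock M w ⊤ + ∑ (innerCyclicFlats M) (cloudFlock M w)
                          ≡ ∑ S (λ A → w (rk M ∸ r A) (∣ A ∣ ∸ r A))
  cloudFlock-ends w = trans
    (sym (∑-when-ends (isCyclicFlat? M) (⊥-cyclic M loopless) (⊤-cyclic M coloopless) (cloudFlock M w)))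
    (∑-cloudFlock M w)

  cloudFlock-⊥ : ∀ w → cloudFlock M w ⊥ ≡ ∑ (cloudSets M ⊥) (λ Z → w (rk M ∸ r Z) 0)
  cloudFlock-⊥ w = ∑-cong (cloudSets M ⊥) λ Z →
    trans (∑-flockSets-⊥ M loopless (λ Y → w (rk M ∸ r Z) (∣ Y ∣ ∸ r Y)))
          (cong (w (rk M ∸ r Z)) (trans (cong (_∸ r ⊥) (∣⊥∣≡0 (suc n))) (0∸n≡0 (r ⊥))))

  cloudFlock-⊤ : ∀ w → cloudFlock M w ⊤ ≡ ∑ (flockSets M ⊤) (λ Y → w 0 (∣ Y ∣ ∸ r Y))
  cloudFlock-⊤ w = trans (∑-cloudSets-⊤ M coloopless _)
                         (∑-cong (flockSets M ⊤) (λ Y → cong (λ a → w a (∣ Y ∣ ∸ r Y)) (n∸n≡0 (rk M))))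

  -- A flat of full rank is E, whose cyclic core is E ≠ ∅.
  ∑-cloudSets-⊥-≡0 : ∀ f → (∀ Z → rk M ∸ r Z ≢ 0 → f Z ≡ 0) → ∑ (cloudSets M ⊥) f ≡ 0
  ∑-cloudSets-⊥-≡0 f f≡0 = trans (∑-filter (λ Z → (cl M Z ≟ₛ Z) ×-dec (ess M Z ≟ₛ ⊥)) S f)
    (∑-≡0 S λ Z → when-≡0 ((cl M Z ≟ₛ Z) ×-dec (ess M Z ≟ₛ ⊥)) λ (Z-flat , ess≡⊥) → f≡0 Z λ corank≡0 →
      ⊥≢⊤ (trans (sym ess≡⊥) (trans (cong (ess M) (flat-of-full-rank M Z-flat corank≡0))
                                    (ess-⊤ M coloopless))))
    where
    ⊥≢⊤ : ⊥ ≢ ⊤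
    ⊥≢⊤ ()

  cloud-⊥-coeff : ∀ k → coeff1 (cloud M ⊥) k ≡ coeff1 (bx (suc n) (rk M)) k - δx (cfSum M) k
  cloud-⊥-coeff zero = begin
    coeff1 (cloud M ⊥) 0
      ≡⟨ coeff1-map (λ _ → 1) (λ Z → rk M ∸ r Z) (cloudSets M ⊥) 0 ⟩
    ℤ.+ ∑ (cloudSets M ⊥) (λ Z → when (rk M ∸ r Z ≡ᵇ 0) 1)
      ≡⟨ cong ℤ.+_ (∑-cloudSets-⊥-≡0 _ λ Z corank≢0 → cong (λ b → when b 1) (≡ᵇ-false corank≢0)) ⟩
    ℤ.+ 0 - ℤ.+ 0
      ≡⟨ cong (_- ℤ.+ 0) (sym (coeff-bx-0 n (rk M))) ⟩
    coeff1 (bx (suc n) (rk M)) 0 - δx (cfSum M) 0 ∎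
    where open ≡-Reasoning
  cloud-⊥-coeff (suc k) = begin
    coeff1 (cloud M ⊥) (suc k)
      ≡⟨ coeff1-map (λ _ → 1) (λ Z → rk M ∸ r Z) (cloudSets M ⊥) (suc k) ⟩
    ℤ.+ ∑ (cloudSets M ⊥) (λ Z → when (rk M ∸ r Z ≡ᵇ suc k) 1)
      ≡⟨ cong ℤ.+_ (sym cloudFlock-⊥≡) ⟩
    ℤ.+ cloudFlock M w ⊥
      ≡⟨ +a≡+b-+c total ⟩
    ℤ.+ ∑ S (λ A → when (rk M ≡ᵇ suc k + ∣ A ∣) 1) - ℤ.+ inner
      ≡⟨ sym (cong₂ _-_ (coeff-bx-suc n (rk M) k) δx-inner) ⟩
    coeff1 (bx (suc n) (rk M)) (suc k) - δx (cfSum M) (suc k) ∎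
    where
    open ≡-Reasoning
    -- δ_x sends x^a y^b to x^(suc k) exactly when a = suc k + b.
    w : ℕ → ℕ → ℕ
    w a b = when (a ≡ᵇ suc k + b) 1
    inner : ℕ
    inner = ∑ (innerCyclicFlats M) (cloudFlock M w)
    δx-inner : δx (cfSum M) (suc k) ≡ ℤ.+ inner
    δx-inner = δx-concatMap _ (cloudFlock M w) (innerCyclicFlats M) k
                 (λ X → δx-monomials _ _ (cloudSets M X) (flockSets M X) k)
    cloudFlock-⊥≡ : cloudFlock M w ⊥ ≡ ∑ (cloudSets M ⊥) (λ Z → when (rk M ∸ r Z ≡ᵇ suc k) 1)
    cloudFlock-⊥≡ = trans (cloudFlock-⊥ w) (∑-cong (cloudSets M ⊥) λ Z →
      cong (λ m → when (rk M ∸ r Z ≡ᵇ m) 1) (+-identityʳ (suc k)))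
    cloudFlock-⊤≡0 : cloudFlock M w ⊤ ≡ 0
    cloudFlock-⊤≡0 = trans (cloudFlock-⊤ w) (∑-≡0 (flockSets M ⊤) (λ _ → refl))
    total : cloudFlock M w ⊥ + inner ≡ ∑ S (λ A → when (rk M ≡ᵇ suc k + ∣ A ∣) 1)
    total = begin
      cloudFlock M w ⊥ + inner                     ≡⟨ cong (_+ inner) (sym (+-identityʳ _)) ⟩
      cloudFlock M w ⊥ + 0 + inner                 ≡⟨ cong (λ h → cloudFlock M w ⊥ + h + inner) (sym cloudFlock-⊤≡0) ⟩
      cloudFlock M w ⊥ + cloudFlock M w ⊤ + inner  ≡⟨ cloudFlock-ends w ⟩
      ∑ S (λ A → w (rk M ∸ r A) (∣ A ∣ ∸ r A))     ≡⟨ ∑-cong S (λ A → cong (λ b → when b 1)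
                                                          (≡ᵇ-∸-cancel (rank-bound M A) (rank-≤-rk M A))) ⟩
      ∑ S (λ A → when (rk M ≡ᵇ suc k + ∣ A ∣) 1)   ∎

  flock-⊤-coeff : ∀ k → coeff1 (flock M ⊤) k ≡ coeff1 (by (suc n) (rk M)) k - δy (cfSum M) k
  flock-⊤-coeff k = begin
    coeff1 (flock M ⊤) k
      ≡⟨ coeff1-map (λ _ → 1) (λ Y → ∣ Y ∣ ∸ r Y) (flockSets M ⊤) k ⟩
    ℤ.+ ∑ (flockSets M ⊤) (λ Y → when (∣ Y ∣ ∸ r Y ≡ᵇ k) 1)
      ≡⟨ cong ℤ.+_ (sym cloudFlock-⊤≡) ⟩
    ℤ.+ cloudFlock M w ⊤
      ≡⟨ +a≡+b-+c total ⟩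
    ℤ.+ ∑ S (λ A → when (∣ A ∣ ≡ᵇ k + rk M) 1) - ℤ.+ inner
      ≡⟨ sym (cong₂ _-_ (coeff-by n (rk M) k) δy-inner) ⟩
    coeff1 (by (suc n) (rk M)) k - δy (cfSum M) k ∎
    where
    open ≡-Reasoning
    -- δ_y sends x^a y^b to y^k exactly when b = k + a.
    w : ℕ → ℕ → ℕ
    w a b = when (b ≡ᵇ k + a) 1
    inner : ℕ
    inner = ∑ (innerCyclicFlats M) (cloudFlock M w)
    δy-inner : δy (cfSum M) k ≡ ℤ.+ inner
    δy-inner = δy-concatMap _ (cloudFlock M w) (innerCyclicFlats M) k
                 (λ X → δy-monomials _ _ (cloudSets M X) (flockSets M X) k)
    cloudFlock-⊤≡ : cloudFlock M w ⊤ ≡ ∑ (flockSets M ⊤) (λ Y → when (∣ Y ∣ ∸ r Y ≡ᵇ k) 1)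
    cloudFlock-⊤≡ = trans (cloudFlock-⊤ w) (∑-cong (flockSets M ⊤) λ Y →
      cong (λ m → when (∣ Y ∣ ∸ r Y ≡ᵇ m) 1) (+-identityʳ k))
    cloudFlock-⊥≡0 : cloudFlock M w ⊥ ≡ 0
    cloudFlock-⊥≡0 = trans (cloudFlock-⊥ w) (∑-cloudSets-⊥-≡0 _ λ Z corank≢0 →
      cong (λ b → when b 1) (≡ᵇ-false λ 0≡k+corank → corank≢0 (m+n≡0⇒n≡0 k (sym 0≡k+corank))))
    total : cloudFlock M w ⊤ + inner ≡ ∑ S (λ A → when (∣ A ∣ ≡ᵇ k + rk M) 1)
    total = begin
      cloudFlock M w ⊤ + inner                     ≡⟨ cong (λ h → h + cloudFlock M w ⊤ + inner)
                                                          (sym cloudFlock-⊥≡0) ⟩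
      cloudFlock M w ⊥ + cloudFlock M w ⊤ + inner  ≡⟨ cloudFlock-ends w ⟩
      ∑ S (λ A → w (rk M ∸ r A) (∣ A ∣ ∸ r A))     ≡⟨ ∑-cong S (λ A → cong (λ b → when b 1)
                                                          (≡ᵇ-∸-cancel (rank-≤-rk M A) (rank-bound M A))) ⟩
      ∑ S (λ A → when (∣ A ∣ ≡ᵇ k + rk M) 1)       ∎

lemma3p1 : (n : ℕ) (M : Matroid n)
    → (∀ e → ¬ IsLoop M e)
    → (∀ e → ¬ IsColoop M e)
    → (∀ k → coeff1 (cloud M ⊥) k ≡ coeff1 (bx n (rk M)) k - δx (cfSum M) k)
      × (∀ k → coeff1 (flock M ⊤) k ≡ coeff1 (by n (rk M)) k - δy (cfSum M) k)
-- For E = ∅ both identities hold by evaluation once r(∅) = 0.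
lemma3p1 zero    M _        _          with rank M [] | rank-⊥ M
... | .0 | refl = (λ { zero → refl ; (suc _) → refl }) , (λ { zero → refl ; (suc _) → refl })
lemma3p1 (suc n) M loopless coloopless =
  cloud-⊥-coeff M loopless coloopless , flock-⊤-coeff M loopless coloopless
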